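{- For all integers $s\ge 1$, $r\ge 2$ and $d\ge 2r-2$, one has $f_{r}(d,s,\ldots,s) > s^{r}$ (with $s$ repeated $r$ times).
   Context: An $s$-convex set in $\mathbb{R}^d$ is a union of $s$ convex sets. For integers $d\ge 1$, $r\ge 2$ and $s_1,\dots,s_r\ge 1$, $f_r(d,s_1,\ldots,s_r)$ denotes the least integer $n$ such that every $n$-point set $P\subseteq\mathbb{R}^d$ admits a partition $P=P_1\sqcup\cdots\sqcup P_r$ with the property that for every choice of $s_i$-convex sets $C_i\supseteq P_i$ ($i\in[r]$) one necessarily has $\bigcap_{i=1}^r C_i\neq\emptyset$. -}

module Defs where

open import Level using (0ℓ)
open import Data.Nat as ℕ using (ℕ)
open import Data.Fin using (Fin)
open import Data.Product using (Σ; ∃; _×_)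
open import Data.Sum using (_⊎_)
open import Relation.Binary.PropositionalEquality using (_≡_)
open import Relation.Binary.Structures using (IsStrictTotalOrder)
open import Relation.Nullary using (¬_)
open import Algebra.Structures using (IsCommutativeRing)
open import Function.Definitions using (Injective)
open import Function.Bundles using (_⇔_)

-- The real numbers, axiomatised as a complete ordered field
-- (unique up to isomorphism; the theorem is quantified over every model).

record CompleteOrderedField : Set₁ where
  infixl 6 _+_
  infixl 7 _*_
  infix 4 _<_ _≤_
  field
    R     : Set
    0# 1# : R
    _+_ _*_ : R → R → R
    -_    : R → R
    _<_   : R → R → Set
    isCommutativeRing  : IsCommutativeRing _≡_ _+_ _*_ -_ 0# 1#
    0≢1                : ¬ (0# ≡ 1#)
    inverse            : ∀ x → ¬ (x ≡ 0#) → Σ R (λ y → x * y ≡ 1#)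
    isStrictTotalOrder : IsStrictTotalOrder _≡_ _<_
    +-monoˡ-<          : ∀ {x y} z → x < y → x + z < y + z
    *-pos              : ∀ {x y} → 0# < x → 0# < y → 0# < x * y

    complete : (S : R → Set) → Σ R S →
               Σ R (λ b → ∀ x → S x → (x < b) ⊎ (x ≡ b)) →
               Σ R (λ u → (∀ x → S x → (x < u) ⊎ (x ≡ u)) ×
                          (∀ b → (∀ x → S x → (x < b) ⊎ (x ≡ b)) → (u < b) ⊎ (u ≡ b)))

  _≤_ : R → R → Set
  x ≤ y = (x < y) ⊎ (x ≡ y)

module Geometry (ℝ : CompleteOrderedField) where
  open CompleteOrderedField ℝ

  Point : ℕ → Set
  Point d = Fin d → R

  Subset : ℕ → Set₁
  Subset d = Point d → Set

  combo : ∀ {d} → R → Point d → Point d → Point d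
  combo t x y i = t * x i + (1# + - t) * y i

  Convex : ∀ {d} → Subset d → Set
  Convex {d} K = ∀ (x y : Point d) (t : R) → 0# ≤ t → t ≤ 1# →
                 K x → K y → K (combo t x y)

  SConvex : ∀ {d} → ℕ → Subset d → Set₁
  SConvex {d} s C = Σ (Fin s → Subset d) λ K →
                      (∀ j → Convex (K j)) × (∀ x → C x ⇔ ∃ λ j → K j x)

  -- A partition P = P₁ ⊔ ⋯ ⊔ P_r of an n-point set (given by an injective
  -- labelling pt : Fin n → ℝ^d) is a colouring c : Fin n → Fin r
  -- (P_i = points of colour i).
  GoodPartition : ∀ {d n r} (s : Fin r → ℕ) → (Fin n → Point d) → (Fin n → Fin r) → Set₁
  GoodPartition {d} {n} {r} s pt c =
    ∀ (C : Fin r → Subset d) → (∀ i → SConvex (s i) (C i)) →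
    (∀ k → C (c k) (pt k)) → ∃ λ (x : Point d) → ∀ i → C i x

  AllAdmit : (d r : ℕ) (s : Fin r → ℕ) → ℕ → Set₁
  AllAdmit d r s n = ∀ (pt : Fin n → Point d) → Injective _≡_ _≡_ pt →
                     ∃ λ (c : Fin n → Fin r) → GoodPartition s pt c

  -- f_r(d,s₁,…,s_r) > m : every n with the property AllAdmit exceeds m,
  -- i.e. the least such n exceeds m.
  FGreater : ∀ {d r} → (Fin r → ℕ) → ℕ → Set₁
  FGreater {d} {r} s m = ∀ n → AllAdmit d r s n → m ℕ.< n

-- Label points by the numbers m < s^r written in base s.  In the plane of the
-- coordinates 2q, 2q + 1 (q < r - 1, whence d ≥ 2r - 2) the point m sits at
-- (X, X² - 2w²) with X = N a + w, where a is its q-th digit and w the number formed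
-- by its higher digits.  The line of slope 2X - 4w through the point of a label v
-- has the other points of v's block (same a, other w) strictly below it and the
-- points of all other blocks strictly above.  Weighting these gaps by rapidly
-- growing factors gives, for every label v, affine functions L₀ = 0, L₁, …,
-- L_r = 0 on ℝ^d with L_{i+1}(v, m) ≤ L_i(v, m) whenever m and v share their i-th
-- digit, strictly for i ≤ 1 unless m = v.  Given a colouring of n ≤ s^r labelled
-- points, let C_i be the union over j < s of the convex sets of those x with
-- L_{i+1}(v, x) ≤ L_i(v, x) for all v with i-th digit j, strictly at step 0 when v
-- is not a point of colour 0 and at step 1 when it is.  Each point of colour i lies
-- in C_i, but a common point x of all C_i, lying in the j_i-th piece of C_i, gives
-- for the label v with digits j_i a chain 0 = L_r(x) ≤ … ≤ L_0(x) = 0 with a strict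
-- step.

module Submission where

open import Defs
open import Level using (0ℓ)
open import Algebra.Bundles using (CommutativeRing)
open import Algebra.Structures using (IsCommutativeRing)
import Algebra.Properties.Ring as RingProperties
import Algebra.Properties.Semiring.Mult as SemiringMult
open import Data.Empty using (⊥; ⊥-elim)
open import Data.Fin as Fin using (Fin; toℕ; fromℕ<)
import Data.Fin.Properties as Fin
open import Data.Integer as ℤ using (ℤ; _◃_)
import Data.Integer.Properties as ℤ
import Data.Integer.Tactic.RingSolver as ℤ
open import Data.Maybe using (nothing)
open import Data.Nat as ℕ using (ℕ; zero; suc; NonZero; _∸_; _^_)
open import Data.Nat.DivMod using (m≡m%n+[m/n]*n; [m+kn]%n≡m%n; m<n⇒m%n≡m; m%n<n; m/n≤m; m<n*o⇒m/o<n)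
import Data.Nat.Properties as ℕ
import Data.Nat.Tactic.RingSolver as ℕ
open import Data.Product using (Σ; _×_; _,_; proj₁; proj₂; swap)
open import Data.Sign as Sign using ()
open import Data.Sum using (_⊎_; inj₁; inj₂; [_,_]′)
open import Function using (id; _∘_)
open import Function.Bundles using (mk⇔)
open import Function.Definitions using (Injective)
open import Relation.Binary.Definitions using (tri<; tri≈; tri>)
open import Relation.Binary.PropositionalEquality
open import Relation.Binary.Structures using (IsStrictTotalOrder; IsPartialOrder)
import Relation.Binary.Construct.StrictToNonStrict as StrictToNonStrict
open import Relation.Nullary using (¬_; yes; no)
open import Tactic.RingSolver using (solve-∀)
open import Tactic.RingSolver.Core.AlmostCommutativeRing using (AlmostCommutativeRing; fromCommutativeRing)

-- The reflective solver recognises only the operations of the ring record it is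
-- handed, hence this separate module; having no zero test, it proves only
-- identities without cancellation, which is why t′ stands in for 1 - t.
module CombinationIdentities (ℝ : CompleteOrderedField) where
  open CompleteOrderedField ℝ using (isCommutativeRing)

  ring : AlmostCommutativeRing 0ℓ 0ℓ
  ring = fromCommutativeRing (record { isCommutativeRing = isCommutativeRing }) (λ _ → nothing)

  open AlmostCommutativeRing ring

  combo-+ : ∀ t t′ x y u v → t * (x + u) + t′ * (y + v) ≡ (t * x + t′ * y) + (t * u + t′ * v)
  combo-+ = solve-∀ ring

  combo-* : ∀ t t′ a x y → t * (a * x) + t′ * (a * y) ≡ a * (t * x + t′ * y)
  combo-* = solve-∀ ring

module OrderedField (ℝ : CompleteOrderedField) where
  open CompleteOrderedField ℝ
  open IsCommutativeRing isCommutativeRing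
    using (+-comm; +-assoc; distribˡ; distribʳ; zeroˡ;
           +-identityˡ; +-identityʳ; *-identityˡ; -‿inverseˡ; -‿inverseʳ)
  commutativeRing : CommutativeRing 0ℓ 0ℓ
  commutativeRing = record { isCommutativeRing = isCommutativeRing }

  open RingProperties (CommutativeRing.ring commutativeRing)
    using (-‿distribˡ-*; -‿distribʳ-*; -‿involutive; -‿anti-homo-+)
  open SemiringMult (CommutativeRing.semiring commutativeRing) using (×-homo-+; ×1-homo-*) renaming (_×_ to _·_)

  module STO = IsStrictTotalOrder isStrictTotalOrder
  open IsPartialOrder (StrictToNonStrict.isPartialOrder _≡_ _<_ STO.isStrictPartialOrder)
    using () renaming (trans to ≤-trans)

  <-trans : ∀ {x y z} → x < y → y < z → x < z
  <-trans = STO.trans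

  <-irrefl : ∀ {x} → ¬ (x < x)
  <-irrefl = STO.irrefl refl

  <-≤-trans : ∀ {x y z} → x < y → y ≤ z → x < z
  <-≤-trans = StrictToNonStrict.<-≤-trans _≡_ _<_ <-trans STO.<-respʳ-≈

  ≤-<-trans : ∀ {x y z} → x ≤ y → y < z → x < z
  ≤-<-trans = StrictToNonStrict.≤-<-trans _≡_ _<_ sym <-trans STO.<-respˡ-≈

  +-monoʳ-< : ∀ {x y} z → x < y → z + x < z + y
  +-monoʳ-< {x} {y} z x<y = subst₂ _<_ (+-comm x z) (+-comm y z) (+-monoˡ-< z x<y)

  +-monoˡ-≤ : ∀ {x y} z → x ≤ y → x + z ≤ y + z
  +-monoˡ-≤ z (inj₁ x<y)  = inj₁ (+-monoˡ-< z x<y)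
  +-monoˡ-≤ z (inj₂ refl) = inj₂ refl

  +-monoʳ-≤ : ∀ {x y} z → x ≤ y → z + x ≤ z + y
  +-monoʳ-≤ z (inj₁ x<y)  = inj₁ (+-monoʳ-< z x<y)
  +-monoʳ-≤ z (inj₂ refl) = inj₂ refl

  +-mono-≤ : ∀ {x y u v} → x ≤ y → u ≤ v → x + u ≤ y + v
  +-mono-≤ {y = y} {u} x≤y u≤v = ≤-trans (+-monoˡ-≤ u x≤y) (+-monoʳ-≤ y u≤v)

  +-mono-<-≤ : ∀ {x y u v} → x < y → u ≤ v → x + u < y + v
  +-mono-<-≤ {y = y} {u} x<y u≤v = <-≤-trans (+-monoˡ-< u x<y) (+-monoʳ-≤ y u≤v)

  +-mono-≤-< : ∀ {x y u v} → x ≤ y → u < v → x + u < y + v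
  +-mono-≤-< {y = y} {u} x≤y u<v = ≤-<-trans (+-monoˡ-≤ u x≤y) (+-monoʳ-< y u<v)

  x<y⇒0<y-x : ∀ {x y} → x < y → 0# < y + - x
  x<y⇒0<y-x {x} x<y = subst (_< _) (-‿inverseʳ x) (+-monoˡ-< (- x) x<y)

  0<y-x⇒x<y : ∀ {x y} → 0# < y + - x → x < y
  0<y-x⇒x<y {x} {y} 0<y-x = subst₂ _<_ (+-identityˡ x) y-x+x≡y (+-monoˡ-< x 0<y-x)
    where
    y-x+x≡y : y + - x + x ≡ y
    y-x+x≡y = trans (+-assoc y (- x) x) (trans (cong (y +_) (-‿inverseˡ x)) (+-identityʳ y))

  -‿0 : - 0# ≡ 0#
  -‿0 = trans (sym (+-identityˡ (- 0#))) (-‿inverseʳ 0#)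

  -‿anti-mono-< : ∀ {x y} → x < y → - y < - x
  -‿anti-mono-< {x} {y} x<y = 0<y-x⇒x<y (subst (0# <_) y-x≡-x--y (x<y⇒0<y-x x<y))
    where
    y-x≡-x--y : y + - x ≡ - x + - - y
    y-x≡-x--y = trans (+-comm y (- x)) (cong (- x +_) (sym (-‿involutive y)))

  -x*-y≡x*y : ∀ x y → - x * - y ≡ x * y
  -x*-y≡x*y x y = trans (sym (-‿distribˡ-* x (- y)))
                    (trans (cong -_ (sym (-‿distribʳ-* x y))) (-‿involutive (x * y)))

  0<1 : 0# < 1#
  0<1 with STO.compare 0# 1#
  ... | tri< 0<1 _ _ = 0<1
  ... | tri≈ _ 0≡1 _ = ⊥-elim (0≢1 0≡1)
  ... | tri> _ _ 1<0 = ⊥-elim (<-irrefl (<-trans 1<0 (subst (0# <_) -1*-1≡1 (*-pos 0<-1 0<-1))))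
    where
    0<-1 : 0# < - 1#
    0<-1 = subst (_< - 1#) -‿0 (-‿anti-mono-< 1<0)
    -1*-1≡1 : - 1# * - 1# ≡ 1#
    -1*-1≡1 = trans (-x*-y≡x*y 1# 1#) (*-identityˡ 1#)

  *-monoˡ-< : ∀ {t x y} → 0# < t → x < y → t * x < t * y
  *-monoˡ-< {t} {x} {y} 0<t x<y = 0<y-x⇒x<y (subst (0# <_) t[y-x]≡ty-tx (*-pos 0<t (x<y⇒0<y-x x<y)))
    where
    t[y-x]≡ty-tx : t * (y + - x) ≡ t * y + - (t * x)
    t[y-x]≡ty-tx = trans (distribˡ t y (- x)) (cong (t * y +_) (sym (-‿distribʳ-* t x)))

  *-monoˡ-≤ : ∀ {t x y} → 0# ≤ t → x ≤ y → t * x ≤ t * y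
  *-monoˡ-≤ (inj₁ 0<t) (inj₁ x<y) = inj₁ (*-monoˡ-< 0<t x<y)
  *-monoˡ-≤ {x = x} {y} (inj₂ refl) (inj₁ _) = inj₂ (trans (zeroˡ x) (sym (zeroˡ y)))
  *-monoˡ-≤ _ (inj₂ refl) = inj₂ refl

  0≤1-t : ∀ {t} → t ≤ 1# → 0# ≤ 1# + - t
  0≤1-t (inj₁ t<1)  = inj₁ (x<y⇒0<y-x t<1)
  0≤1-t (inj₂ refl) = inj₂ (sym (-‿inverseʳ 1#))

  combo-const : ∀ t c → t * c + (1# + - t) * c ≡ c
  combo-const t c = begin
    t * c + (1# + - t) * c     ≡⟨ sym (distribʳ c t (1# + - t)) ⟩
    (t + (1# + - t)) * c       ≡⟨ cong (_* c) (+-comm t (1# + - t)) ⟩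
    ((1# + - t) + t) * c       ≡⟨ cong (_* c) (+-assoc 1# (- t) t) ⟩
    (1# + (- t + t)) * c       ≡⟨ cong (λ z → (1# + z) * c) (-‿inverseˡ t) ⟩
    (1# + 0#) * c              ≡⟨ cong (_* c) (+-identityʳ 1#) ⟩
    1# * c                     ≡⟨ *-identityˡ c ⟩
    c                          ∎
    where open ≡-Reasoning

  combo-mono-≤ : ∀ {t x y u v} → 0# ≤ t → t ≤ 1# → x ≤ y → u ≤ v →
                 t * x + (1# + - t) * u ≤ t * y + (1# + - t) * v
  combo-mono-≤ 0≤t t≤1 x≤y u≤v = +-mono-≤ (*-monoˡ-≤ 0≤t x≤y) (*-monoˡ-≤ (0≤1-t t≤1) u≤v)

  combo-mono-< : ∀ {t x y u v} → 0# ≤ t → t ≤ 1# → x < y → u < v →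
                 t * x + (1# + - t) * u < t * y + (1# + - t) * v
  combo-mono-< (inj₁ 0<t) t≤1 x<y u<v = +-mono-<-≤ (*-monoˡ-< 0<t x<y) (*-monoˡ-≤ (0≤1-t t≤1) (inj₁ u<v))
  combo-mono-< (inj₂ refl) _  x<y u<v = +-mono-≤-< (*-monoˡ-≤ (inj₂ refl) (inj₁ x<y)) (*-monoˡ-< 0<1-0 u<v)
    where
    0<1-0 : 0# < 1# + - 0#
    0<1-0 = subst (0# <_) (sym (trans (cong (1# +_) -‿0) (+-identityʳ 1#))) 0<1

  descending-chain : ∀ (f : ℕ → R) n → (∀ i → i ℕ.< n → f (suc i) ≤ f i) → ∀ j → j ℕ.≤ n → f n ≤ f j
  descending-chain f zero    _    zero ℕ.z≤n = inj₂ refl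
  descending-chain f (suc n) step j    j≤n with ℕ.m≤n⇒m<n∨m≡n j≤n
  ... | inj₂ refl = inj₂ refl
  ... | inj₁ j<n  = ≤-trans (step n (ℕ.n<1+n n))
                      (descending-chain f n (λ i i<n → step i (ℕ.m<n⇒m<1+n i<n)) j (ℕ.≤-pred j<n))

  ιℕ : ℕ → R
  ιℕ n = n · 1#

  0<ιℕ-suc : ∀ n → 0# < ιℕ (suc n)
  0<ιℕ-suc zero    = subst (0# <_) (sym (+-identityʳ 1#)) 0<1
  0<ιℕ-suc (suc n) = subst (_< ιℕ (suc (suc n))) (+-identityˡ 0#) (+-mono-<-≤ 0<1 (inj₁ (0<ιℕ-suc n)))

  ιℕ-mono-< : ∀ {m n} → m ℕ.< n → ιℕ m < ιℕ n
  ιℕ-mono-< {zero}  {suc n} _             = 0<ιℕ-suc n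
  ιℕ-mono-< {suc m} {suc n} (ℕ.s≤s m<n) = +-monoʳ-< 1# (ιℕ-mono-< m<n)

  ι : ℤ → R
  ι (ℤ.+ n)    = ιℕ n
  ι ℤ.-[1+ n ] = - ιℕ (suc n)

  [o+x]-[o+y]≡x-y : ∀ o x y → (o + x) + - (o + y) ≡ x + - y
  [o+x]-[o+y]≡x-y o x y = begin
    (o + x) + - (o + y)     ≡⟨ cong ((o + x) +_) (-‿anti-homo-+ o y) ⟩
    (o + x) + (- y + - o)   ≡⟨ +-assoc o x (- y + - o) ⟩
    o + (x + (- y + - o))   ≡⟨ cong (o +_) (sym (+-assoc x (- y) (- o))) ⟩
    o + ((x + - y) + - o)   ≡⟨ cong (o +_) (+-comm (x + - y) (- o)) ⟩
    o + (- o + (x + - y))   ≡⟨ sym (+-assoc o (- o) (x + - y)) ⟩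
    (o + - o) + (x + - y)   ≡⟨ cong (_+ (x + - y)) (-‿inverseʳ o) ⟩
    0# + (x + - y)          ≡⟨ +-identityˡ _ ⟩
    x + - y                 ∎
    where open ≡-Reasoning

  ι-⊖ : ∀ m n → ι (m ℤ.⊖ n) ≡ ιℕ m + - ιℕ n
  ι-⊖ zero    zero    = sym (trans (+-identityˡ (- 0#)) -‿0)
  ι-⊖ zero    (suc n) = sym (+-identityˡ _)
  ι-⊖ (suc m) zero    = sym (trans (cong (ιℕ (suc m) +_) -‿0) (+-identityʳ _))
  ι-⊖ (suc m) (suc n) = begin
    ι (suc m ℤ.⊖ suc n)             ≡⟨ cong ι (ℤ.[1+m]⊖[1+n]≡m⊖n m n) ⟩
    ι (m ℤ.⊖ n)                     ≡⟨ ι-⊖ m n ⟩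
    ιℕ m + - ιℕ n                   ≡⟨ sym ([o+x]-[o+y]≡x-y 1# (ιℕ m) (ιℕ n)) ⟩
    ιℕ (suc m) + - ιℕ (suc n)       ∎
    where open ≡-Reasoning

  ι-neg : ∀ i → ι (ℤ.- i) ≡ - ι i
  ι-neg ℤ.-[1+ n ]     = sym (-‿involutive _)
  ι-neg (ℤ.+ zero)     = sym -‿0
  ι-neg (ℤ.+ (suc n))  = refl

  ι-+ : ∀ i j → ι (i ℤ.+ j) ≡ ι i + ι j
  ι-+ ℤ.-[1+ m ] ℤ.-[1+ n ] = begin
    - ιℕ (suc (suc (m ℕ.+ n)))      ≡⟨ cong (λ k → - ιℕ (suc k)) (sym (ℕ.+-suc m n)) ⟩
    - ιℕ (suc m ℕ.+ suc n)          ≡⟨ cong -_ (×-homo-+ 1# (suc m) (suc n)) ⟩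
    - (ιℕ (suc m) + ιℕ (suc n))     ≡⟨ -‿anti-homo-+ _ _ ⟩
    - ιℕ (suc n) + - ιℕ (suc m)     ≡⟨ +-comm _ _ ⟩
    - ιℕ (suc m) + - ιℕ (suc n)     ∎
    where open ≡-Reasoning
  ι-+ ℤ.-[1+ m ] (ℤ.+ n)    = trans (ι-⊖ n (suc m)) (+-comm _ _)
  ι-+ (ℤ.+ m)    ℤ.-[1+ n ] = ι-⊖ m (suc n)
  ι-+ (ℤ.+ m)    (ℤ.+ n)    = ×-homo-+ 1# m n

  ι-* : ∀ i j → ι (i ℤ.* j) ≡ ι i * ι j
  ι-* ℤ.-[1+ m ] ℤ.-[1+ n ] = begin
    ι (ℤ.+ (suc m ℕ.* suc n))       ≡⟨ ×1-homo-* (suc m) (suc n) ⟩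
    ιℕ (suc m) * ιℕ (suc n)         ≡⟨ sym (-x*-y≡x*y (ιℕ (suc m)) (ιℕ (suc n))) ⟩
    - ιℕ (suc m) * - ιℕ (suc n)     ∎
    where open ≡-Reasoning
  ι-* ℤ.-[1+ m ] (ℤ.+ n)    = begin
    ι (Sign.- ◃ (suc m ℕ.* n))      ≡⟨ cong ι (ℤ.-◃n≡-n (suc m ℕ.* n)) ⟩
    ι (ℤ.- ℤ.+ (suc m ℕ.* n))       ≡⟨ ι-neg (ℤ.+ (suc m ℕ.* n)) ⟩
    - ιℕ (suc m ℕ.* n)              ≡⟨ cong -_ (×1-homo-* (suc m) n) ⟩
    - (ιℕ (suc m) * ιℕ n)           ≡⟨ -‿distribˡ-* _ _ ⟩
    - ιℕ (suc m) * ιℕ n             ∎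
    where open ≡-Reasoning
  ι-* (ℤ.+ m)    ℤ.-[1+ n ] = begin
    ι (Sign.- ◃ (m ℕ.* suc n))      ≡⟨ cong ι (ℤ.-◃n≡-n (m ℕ.* suc n)) ⟩
    ι (ℤ.- ℤ.+ (m ℕ.* suc n))       ≡⟨ ι-neg (ℤ.+ (m ℕ.* suc n)) ⟩
    - ιℕ (m ℕ.* suc n)              ≡⟨ cong -_ (×1-homo-* m (suc n)) ⟩
    - (ιℕ m * ιℕ (suc n))           ≡⟨ -‿distribʳ-* _ _ ⟩
    ιℕ m * - ιℕ (suc n)             ∎
    where open ≡-Reasoning
  ι-* (ℤ.+ m)    (ℤ.+ n)    = trans (cong ι (ℤ.+◃n≡+n (m ℕ.* n))) (×1-homo-* m n)

  ι-mono-< : ∀ {i j} → i ℤ.< j → ι i < ι j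
  ι-mono-< (ℤ.-<- n<m)     = -‿anti-mono-< (ιℕ-mono-< (ℕ.s≤s n<m))
  ι-mono-< (ℤ.-<+ {m} {n}) = <-≤-trans (subst (- ιℕ (suc m) <_) -‿0 (-‿anti-mono-< (0<ιℕ-suc m))) (0≤ιℕ n)
    where
    0≤ιℕ : ∀ n → 0# ≤ ιℕ n
    0≤ιℕ zero    = inj₂ refl
    0≤ιℕ (suc n) = inj₁ (0<ιℕ-suc n)
  ι-mono-< (ℤ.+<+ m<n)     = ιℕ-mono-< m<n

  ι-injective : ∀ {i j} → ι i ≡ ι j → i ≡ j
  ι-injective {i} {j} ιi≡ιj with ℤ.<-cmp i j
  ... | tri< i<j _ _ = ⊥-elim (<-irrefl (subst (_< ι j) ιi≡ιj (ι-mono-< i<j)))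
  ... | tri≈ _ i≡j _ = i≡j
  ... | tri> _ _ j<i = ⊥-elim (<-irrefl (subst (ι j <_) ιi≡ιj (ι-mono-< j<i)))

  ι-line : ∀ k h a x c → ι (k ℤ.* (h ℤ.- a ℤ.* x ℤ.- c)) ≡ ι k * (ι h + - ι a * ι x + - ι c)
  ι-line k h a x c = begin
    ι (k ℤ.* (h ℤ.- a ℤ.* x ℤ.- c))
      ≡⟨ ι-* k _ ⟩
    ι k * ι (h ℤ.- a ℤ.* x ℤ.- c)
      ≡⟨ cong (ι k *_) (ι-+ (h ℤ.- a ℤ.* x) (ℤ.- c)) ⟩
    ι k * (ι (h ℤ.- a ℤ.* x) + ι (ℤ.- c))
      ≡⟨ cong (λ z → ι k * (z + ι (ℤ.- c))) (ι-+ h (ℤ.- (a ℤ.* x))) ⟩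
    ι k * (ι h + ι (ℤ.- (a ℤ.* x)) + ι (ℤ.- c))
      ≡⟨ cong₂ (λ y z → ι k * (ι h + y + z)) (ι-neg (a ℤ.* x)) (ι-neg c) ⟩
    ι k * (ι h + - ι (a ℤ.* x) + - ι c)
      ≡⟨ cong (λ y → ι k * (ι h + - y + - ι c)) (ι-* a x) ⟩
    ι k * (ι h + - (ι a * ι x) + - ι c)
      ≡⟨ cong (λ y → ι k * (ι h + y + - ι c)) (-‿distribˡ-* (ι a) (ι x)) ⟩
    ι k * (ι h + - ι a * ι x + - ι c)
      ∎
    where open ≡-Reasoning

module Convexity (ℝ : CompleteOrderedField) where
  open CompleteOrderedField ℝ
  open OrderedField ℝ
  open CombinationIdentities ℝ using (combo-+; combo-*)
  open Geometry ℝ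

  Affine : ∀ {d} → (Point d → R) → Set
  Affine f = ∀ t x y → f (combo t x y) ≡ t * f x + (1# + - t) * f y

  module _ {d : ℕ} where

    affine-coordinate : ∀ i → Affine {d} (λ x → x i)
    affine-coordinate i t x y = refl

    affine-const : ∀ c → Affine {d} (λ _ → c)
    affine-const c t x y = sym (combo-const t c)

    affine-+ : ∀ {f g} → Affine {d} f → Affine g → Affine (λ x → f x + g x)
    affine-+ {f} {g} f-aff g-aff t x y =
      trans (cong₂ _+_ (f-aff t x y) (g-aff t x y)) (sym (combo-+ t (1# + - t) (f x) (f y) (g x) (g y)))

    affine-* : ∀ a {f} → Affine {d} f → Affine (λ x → a * f x)
    affine-* a {f} f-aff t x y = trans (cong (a *_) (f-aff t x y)) (sym (combo-* t (1# + - t) a (f x) (f y)))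

    convex-≤ : ∀ {f g} → Affine {d} f → Affine g → Convex (λ x → f x ≤ g x)
    convex-≤ f-aff g-aff x y t 0≤t t≤1 fx≤gx fy≤gy =
      subst₂ _≤_ (sym (f-aff t x y)) (sym (g-aff t x y)) (combo-mono-≤ 0≤t t≤1 fx≤gx fy≤gy)

    convex-< : ∀ {f g} → Affine {d} f → Affine g → Convex (λ x → f x < g x)
    convex-< f-aff g-aff x y t 0≤t t≤1 fx<gx fy<gy =
      subst₂ _<_ (sym (f-aff t x y)) (sym (g-aff t x y)) (combo-mono-< 0≤t t≤1 fx<gx fy<gy)

    convex-× : ∀ {K L : Subset d} → Convex K → Convex L → Convex (λ x → K x × L x)
    convex-× K-conv L-conv x y t 0≤t t≤1 (Kx , Lx) (Ky , Ly) =
      K-conv x y t 0≤t t≤1 Kx Ky , L-conv x y t 0≤t t≤1 Lx Ly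

    convex-Π : ∀ {I : Set} {K : I → Subset d} → (∀ i → Convex (K i)) → Convex (λ x → ∀ i → K i x)
    convex-Π K-conv x y t 0≤t t≤1 Kx Ky i = K-conv i x y t 0≤t t≤1 (Kx i) (Ky i)

module _ where
  open import Data.Nat using (_+_; _*_; _^_; _<_; _≤_; _/_; _%_)

  divMod-unique : ∀ {b a a′ q q′} .{{_ : NonZero b}} → a < b → a′ < b →
                  a + b * q ≡ a′ + b * q′ → a ≡ a′ × q ≡ q′
  divMod-unique {b} {a} {a′} {q} {q′} a<b a′<b eq = a≡a′ , q≡q′
    where
    remainder : ∀ {a} q → a < b → (a + b * q) % b ≡ a
    remainder {a} q a<b = trans (cong (λ x → (a + x) % b) (ℕ.*-comm b q)) (trans ([m+kn]%n≡m%n a q b) (m<n⇒m%n≡m a<b))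
    a≡a′ : a ≡ a′
    a≡a′ = trans (sym (remainder q a<b)) (trans (cong (_% b) eq) (remainder q′ a′<b))
    q≡q′ : q ≡ q′
    q≡q′ = ℕ.*-cancelˡ-≡ q q′ b (ℕ.+-cancelˡ-≡ a′ _ _ (subst (λ x → x + b * q ≡ a′ + b * q′) a≡a′ eq))

  module Digits (s : ℕ) .{{_ : NonZero s}} where

    digit : ℕ → ℕ → ℕ
    digit zero    m = m % s
    digit (suc q) m = digit q (m / s)

    dropDigits : ℕ → ℕ → ℕ
    dropDigits zero    m = m
    dropDigits (suc t) m = dropDigits t (m / s)

    digit<s : ∀ q m → digit q m < s
    digit<s zero    m = m%n<n m s
    digit<s (suc q) m = digit<s q (m / s)

    dropDigits-split : ∀ t m → dropDigits t m ≡ digit t m + s * dropDigits (suc t) m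
    dropDigits-split zero    m = trans (m≡m%n+[m/n]*n m s) (cong (m % s +_) (ℕ.*-comm (m / s) s))
    dropDigits-split (suc t) m = dropDigits-split t (m / s)

    dropDigits≤ : ∀ t m → dropDigits t m ≤ m
    dropDigits≤ zero    m = ℕ.≤-refl
    dropDigits≤ (suc t) m = ℕ.≤-trans (dropDigits≤ t (m / s)) (m/n≤m m s)

    dropDigits-small : ∀ t m → m < s ^ t → dropDigits t m ≡ 0
    dropDigits-small zero    m m<1   = ℕ.n<1⇒n≡0 m<1
    dropDigits-small (suc t) m m<s^t =
      dropDigits-small t (m / s) (m<n*o⇒m/o<n (subst (m <_) (ℕ.*-comm s (s ^ t)) m<s^t))

    dropDigits-cong : ∀ t {m v} → digit t m ≡ digit t v → dropDigits (suc t) m ≡ dropDigits (suc t) v →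
                      dropDigits t m ≡ dropDigits t v
    dropDigits-cong t {m} {v} digit≡ drop≡ =
      trans (dropDigits-split t m) (trans (cong₂ (λ a q → a + s * q) digit≡ drop≡) (sym (dropDigits-split t v)))

    encode : ∀ r → (Fin r → Fin s) → ℕ
    encode zero    b = 0
    encode (suc r) b = toℕ (b Fin.zero) + s * encode r (b ∘ Fin.suc)

    encode<s^r : ∀ r b → encode r b < s ^ r
    encode<s^r zero    b = ℕ.s≤s ℕ.z≤n
    encode<s^r (suc r) b = begin-strict
      toℕ (b Fin.zero) + s * e   <⟨ ℕ.+-monoˡ-< (s * e) (Fin.toℕ<n (b Fin.zero)) ⟩
      s + s * e                  ≡⟨ sym (ℕ.*-suc s e) ⟩
      s * suc e                  ≤⟨ ℕ.*-monoʳ-≤ s (encode<s^r r (b ∘ Fin.suc)) ⟩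
      s * s ^ r                  ∎
      where
      open ℕ.≤-Reasoning
      e = encode r (b ∘ Fin.suc)

    encode-split : ∀ r b → digit 0 (encode (suc r) b) ≡ toℕ (b Fin.zero) ×
                           dropDigits 1 (encode (suc r) b) ≡ encode r (b ∘ Fin.suc)
    encode-split r b = divMod-unique (digit<s 0 (encode (suc r) b)) (Fin.toℕ<n (b Fin.zero))
                         (sym (dropDigits-split 0 (encode (suc r) b)))

    digit-encode : ∀ r b (i : Fin r) → digit (toℕ i) (encode r b) ≡ toℕ (b i)
    digit-encode (suc r) b Fin.zero    = proj₁ (encode-split r b)
    digit-encode (suc r) b (Fin.suc i) =
      trans (cong (digit (toℕ i)) (proj₂ (encode-split r b))) (digit-encode r (b ∘ Fin.suc) i)

module _ where
  open import Data.Integer using (+_; _+_; _*_; _-_; -_; _≤_; ∣_∣; +≤+; +<+)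

  i*i≡+∣i∣*∣i∣ : ∀ i → i * i ≡ + (∣ i ∣ ℕ.* ∣ i ∣)
  i*i≡+∣i∣*∣i∣ (+ n)      = ℤ.+◃n≡+n (n ℕ.* n)
  i*i≡+∣i∣*∣i∣ ℤ.-[1+ n ] = refl

  -[i*i]≤-1 : ∀ i → ¬ (i ≡ + 0) → - (i * i) ≤ ℤ.-1ℤ
  -[i*i]≤-1 (+ zero)    i≢0 = ⊥-elim (i≢0 refl)
  -[i*i]≤-1 (+ suc n)   _   = ℤ.-≤- ℕ.z≤n
  -[i*i]≤-1 ℤ.-[1+ n ]  _   = ℤ.-≤- ℕ.z≤n

  +-square-mono : ∀ {p q} → p ℕ.≤ q → + p * + p ≤ + q * + q
  +-square-mono {p} {q} p≤q =
    subst₂ _≤_ (sym (i*i≡+∣i∣*∣i∣ (+ p))) (sym (i*i≡+∣i∣*∣i∣ (+ q))) (+≤+ (ℕ.*-mono-≤ p≤q p≤q))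

  -- (X a w, Y a w) is the point labelled by block a and offset w, and gap a w a′ w′ is
  -- the height of the point of (a′, w′) above the line of slope `slope a w` through
  -- the point of (a, w).
  module TangentGap (M : ℕ) where

    N : ℕ
    N = suc (4 ℕ.* M)

    B : ℕ
    B = 4 ℕ.* (M ℕ.* M)

    X : ℕ → ℕ → ℤ
    X a w = + N * + a + + w

    Y : ℕ → ℕ → ℤ
    Y a w = X a w * X a w - + 2 * (+ w * + w)

    slope : ℕ → ℕ → ℤ
    slope a w = + 2 * X a w - + 4 * + w

    intercept : ℕ → ℕ → ℤ
    intercept a w = Y a w - slope a w * X a w

    gap : ℕ → ℕ → ℕ → ℕ → ℤ
    gap a w a′ w′ = Y a′ w′ - slope a w * X a′ w′ - intercept a w

    squares : ℕ → ℕ → ℤ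
    squares w w′ = + 2 * (+ w′ * + w′) + + 2 * (+ w * + w)

    X-injective : ∀ {a w a′ w′} → w ℕ.≤ M → w′ ℕ.≤ M → X a w ≡ X a′ w′ → a ≡ a′ × w ≡ w′
    X-injective {a} {w} {a′} {w′} w≤M w′≤M X≡X′ =
      swap (divMod-unique (w<N w≤M) (w<N w′≤M) (ℤ.+-injective (begin
        + (w ℕ.+ N ℕ.* a)     ≡⟨ +-expansion a w ⟩
        X a w                 ≡⟨ X≡X′ ⟩
        X a′ w′               ≡⟨ sym (+-expansion a′ w′) ⟩
        + (w′ ℕ.+ N ℕ.* a′)   ∎)))
      where
      open ≡-Reasoning
      w<N : ∀ {w} → w ℕ.≤ M → w ℕ.< N
      w<N w≤M = ℕ.s≤s (ℕ.≤-trans w≤M (ℕ.m≤n*m M 4))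
      +-expansion : ∀ a w → + (w ℕ.+ N ℕ.* a) ≡ X a w
      +-expansion a w =
        trans (ℤ.pos-+ w (N ℕ.* a)) (trans (ℤ.+-comm (+ w) (+ (N ℕ.* a))) (cong (_+ + w) (ℤ.pos-* N a)))

    gap-closed-form : ∀ a w a′ w′ →
      gap a w a′ w′ ≡ (X a′ w′ - X a w + + 2 * + w) * (X a′ w′ - X a w + + 2 * + w) - squares w w′
    gap-closed-form a w a′ w′ = identity (X a w) (+ w) (X a′ w′) (+ w′)
      where
      identity : ∀ x w x′ w′ →
        x′ * x′ - + 2 * (w′ * w′) - (+ 2 * x - + 4 * w) * x′ - (x * x - + 2 * (w * w) - (+ 2 * x - + 4 * w) * x)
          ≡ (x′ - x + + 2 * w) * (x′ - x + + 2 * w) - (+ 2 * (w′ * w′) + + 2 * (w * w))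
      identity = ℤ.solve-∀

    gap-same-block : ∀ a w w′ → gap a w a w′ ≡ - ((+ w′ - + w) * (+ w′ - + w))
    gap-same-block a w w′ = trans (gap-closed-form a w a w′) (identity (+ N * + a) (+ w) (+ w′))
      where
      identity : ∀ n w w′ →
        (n + w′ - (n + w) + + 2 * w) * (n + w′ - (n + w) + + 2 * w) - (+ 2 * (w′ * w′) + + 2 * (w * w))
          ≡ - ((w′ - w) * (w′ - w))
      identity = ℤ.solve-∀

    gap-self : ∀ a w → gap a w a w ≡ + 0
    gap-self a w = trans (gap-same-block a w w) (cong (λ z → - (z * z)) (ℤ.+-inverseʳ (+ w)))

    gap-same-block-≤-1 : ∀ a w w′ → w ≢ w′ → gap a w a w′ ≤ ℤ.-1ℤ
    gap-same-block-≤-1 a w w′ w≢w′ =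
      subst (_≤ ℤ.-1ℤ) (sym (gap-same-block a w w′)) (-[i*i]≤-1 (+ w′ - + w) w′-w≢0)
      where
      w′-w≢0 : + w′ - + w ≢ + 0
      w′-w≢0 w′-w≡0 = w≢w′ (sym (ℤ.+-injective (ℤ.i-j≡0⇒i≡j (+ w′) (+ w) w′-w≡0)))

    squares≤B : ∀ {w w′} → w ℕ.≤ M → w′ ℕ.≤ M → squares w w′ ≤ + B
    squares≤B {w} {w′} w≤M w′≤M = begin
      squares w w′                            ≤⟨ ℤ.+-mono-≤ (twice (+-square-mono w′≤M)) (twice (+-square-mono w≤M)) ⟩
      + 2 * (+ M * + M) + + 2 * (+ M * + M)   ≡⟨ identity (+ M) ⟩
      + 4 * (+ M * + M)                       ≡⟨ sym (trans (ℤ.pos-* 4 (M ℕ.* M)) (cong (+ 4 *_) (ℤ.pos-* M M))) ⟩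
      + B                                     ∎
      where
      open ℤ.≤-Reasoning
      twice = ℤ.*-monoˡ-≤-nonNeg (+ 2)
      identity : ∀ m → + 2 * (m * m) + + 2 * (m * m) ≡ + 4 * (m * m)
      identity = ℤ.solve-∀

    gap-lower-bound : ∀ a w a′ w′ → w ℕ.≤ M → w′ ℕ.≤ M → - + B ≤ gap a w a′ w′
    gap-lower-bound a w a′ w′ w≤M w′≤M = begin
      - + B                  ≡⟨ sym (ℤ.+-identityˡ _) ⟩
      + 0 - + B              ≤⟨ ℤ.+-mono-≤ 0≤Z*Z (ℤ.neg-mono-≤ (squares≤B w≤M w′≤M)) ⟩
      Z * Z - squares w w′   ≡⟨ sym (gap-closed-form a w a′ w′) ⟩
      gap a w a′ w′          ∎
      where
      open ℤ.≤-Reasoning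
      Z = X a′ w′ - X a w + + 2 * + w
      0≤Z*Z : + 0 ≤ Z * Z
      0≤Z*Z = subst (+ 0 ≤_) (sym (i*i≡+∣i∣*∣i∣ Z)) (+≤+ ℕ.z≤n)

    -- N > 4M keeps the points of different blocks far apart along the X axis.
    block-separation : ∀ {a w a′ w′} → a ≢ a′ → w ℕ.≤ M → w′ ℕ.≤ M →
                       2 ℕ.* M ℕ.+ 1 ℕ.≤ ∣ X a′ w′ - X a w + + 2 * + w ∣
    block-separation {a} {w} {a′} {w′} a≢a′ w≤M w′≤M = ℕ.+-cancelʳ-≤ (M ℕ.+ M) _ _ (begin
      2 ℕ.* M ℕ.+ 1 ℕ.+ (M ℕ.+ M)   ≡⟨ ℕ-identity M ⟩
      N ℕ.* 1                        ≤⟨ ℕ.*-monoʳ-≤ N 1≤∣e∣ ⟩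
      N ℕ.* ∣ e ∣                    ≡⟨ sym (ℤ.∣i*j∣≡∣i∣*∣j∣ (+ N) e) ⟩
      ∣ + N * e ∣                    ≡⟨ cong ∣_∣ (ℤ-identity (+ N) (+ a) (+ w) (+ a′) (+ w′)) ⟩
      ∣ Z - (+ w′ + + w) ∣           ≤⟨ ℤ.∣i-j∣≤∣i∣+∣j∣ Z (+ w′ + + w) ⟩
      ∣ Z ∣ ℕ.+ ∣ + w′ + + w ∣       ≡⟨ cong (λ k → ∣ Z ∣ ℕ.+ ∣ k ∣) (sym (ℤ.pos-+ w′ w)) ⟩
      ∣ Z ∣ ℕ.+ (w′ ℕ.+ w)           ≤⟨ ℕ.+-monoʳ-≤ ∣ Z ∣ (ℕ.+-mono-≤ w′≤M w≤M) ⟩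
      ∣ Z ∣ ℕ.+ (M ℕ.+ M)            ∎)
      where
      open ℕ.≤-Reasoning
      Z = X a′ w′ - X a w + + 2 * + w
      e = + a′ - + a
      1≤∣e∣ : 1 ℕ.≤ ∣ e ∣
      1≤∣e∣ = ℕ.n≢0⇒n>0 (λ ∣e∣≡0 → a≢a′ (sym (ℤ.+-injective (ℤ.i-j≡0⇒i≡j _ _ (ℤ.∣i∣≡0⇒i≡0 ∣e∣≡0)))))
      ℕ-identity : ∀ m → 2 ℕ.* m ℕ.+ 1 ℕ.+ (m ℕ.+ m) ≡ suc (4 ℕ.* m) ℕ.* 1
      ℕ-identity = ℕ.solve-∀
      ℤ-identity : ∀ n a w a′ w′ → n * (a′ - a) ≡ n * a′ + w′ - (n * a + w) + + 2 * w - (w′ + w)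
      ℤ-identity = ℤ.solve-∀

    gap-other-block : ∀ {a w a′ w′} → a ≢ a′ → w ℕ.≤ M → w′ ℕ.≤ M → + 1 ≤ gap a w a′ w′
    gap-other-block {a} {w} {a′} {w′} a≢a′ w≤M w′≤M = begin
      + 1                    ≤⟨ +≤+ (ℕ.s≤s ℕ.z≤n) ⟩
      + N                    ≡⟨ sym (cancel (+ B) (+ N)) ⟩
      + B + + N - + B        ≡⟨ cong (_- + B) (trans (sym (ℤ.pos-+ B N)) (cong +_ (square M))) ⟩
      + (C ℕ.* C) - + B      ≤⟨ ℤ.+-mono-≤ C*C≤Z*Z (ℤ.neg-mono-≤ (squares≤B w≤M w′≤M)) ⟩
      Z * Z - squares w w′   ≡⟨ sym (gap-closed-form a w a′ w′) ⟩
      gap a w a′ w′          ∎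
      where
      open ℤ.≤-Reasoning
      Z = X a′ w′ - X a w + + 2 * + w
      C = 2 ℕ.* M ℕ.+ 1
      C≤∣Z∣ = block-separation a≢a′ w≤M w′≤M
      C*C≤Z*Z : + (C ℕ.* C) ≤ Z * Z
      C*C≤Z*Z = subst (+ (C ℕ.* C) ≤_) (sym (i*i≡+∣i∣*∣i∣ Z)) (+≤+ (ℕ.*-mono-≤ C≤∣Z∣ C≤∣Z∣))
      cancel : ∀ i k → i + k - i ≡ k
      cancel = ℤ.solve-∀
      square : ∀ m → 4 ℕ.* (m ℕ.* m) ℕ.+ suc (4 ℕ.* m) ≡ (2 ℕ.* m ℕ.+ 1) ℕ.* (2 ℕ.* m ℕ.+ 1)
      square = ℕ.solve-∀

  module Levels (r s : ℕ) .{{_ : NonZero s}} where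
    open Digits s
    M : ℕ
    M = s ^ r
    open TangentGap M

    weight : ℕ → ℕ
    weight t = suc B ^ t

    planeGap : ℕ → ℕ → ℕ → ℤ
    planeGap q v m = gap (digit q v) (dropDigits (suc q) v) (digit q m) (dropDigits (suc q) m)

    level : ℕ → ℕ → ℕ → ℤ
    level zero    v m = + 0
    level (suc q) v m with suc q ℕ.<? r
    ... | yes _ = + weight (suc q) * planeGap q v m
    ... | no  _ = + 0

    level-inside : ∀ {q} v m → suc q ℕ.< r → level (suc q) v m ≡ + weight (suc q) * planeGap q v m
    level-inside {q} v m q<r with suc q ℕ.<? r
    ... | yes _   = refl
    ... | no  q≮r = ⊥-elim (q≮r q<r)

    dropDigits≤M : ∀ {u} → u ℕ.< M → ∀ t → dropDigits t u ℕ.≤ M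
    dropDigits≤M u<M t = ℕ.≤-trans (dropDigits≤ t _) (ℕ.<⇒≤ u<M)

    1≤weight : ∀ t → 1 ℕ.≤ weight t
    1≤weight zero    = ℕ.≤-refl
    1≤weight (suc t) = ℕ.*-mono-≤ {1} {suc B} (ℕ.s≤s ℕ.z≤n) (1≤weight t)

    weight*B<weight-suc : ∀ i → weight i ℕ.* B ℕ.< weight (suc i)
    weight*B<weight-suc i = begin-strict
      weight i ℕ.* B               <⟨ ℕ.m<n+m _ (1≤weight i) ⟩
      weight i ℕ.+ weight i ℕ.* B  ≡⟨ sym (ℕ.*-suc (weight i) B) ⟩
      weight i ℕ.* suc B           ≡⟨ ℕ.*-comm (weight i) (suc B) ⟩
      weight (suc i)               ∎
      where open ℕ.≤-Reasoning

    module _ {v m : ℕ} (v<M : v ℕ.< M) (m<M : m ℕ.< M) where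

      level-agree : ∀ i → digit i m ≡ digit i v → dropDigits (suc i) m ≡ dropDigits (suc i) v →
                    level (suc i) v m ≡ + 0
      level-agree i digit≡ drop≡ with suc i ℕ.<? r
      ... | yes _ = trans (cong (+ weight (suc i) *_) gap≡0) (ℤ.*-zeroʳ (+ weight (suc i)))
        where
        gap≡0 : planeGap i v m ≡ + 0
        gap≡0 rewrite digit≡ | drop≡ = gap-self (digit i v) (dropDigits (suc i) v)
      ... | no  _ = refl

      0<level : ∀ i → suc i ℕ.< r → digit i m ≢ digit i v → + 0 ℤ.< level (suc i) v m
      0<level i i<r digit≢ = begin-strict
        + 0                                 <⟨ +<+ (1≤weight (suc i)) ⟩
        + weight (suc i)                    ≡⟨ sym (ℤ.*-identityʳ _) ⟩
        + weight (suc i) * + 1              ≤⟨ ℤ.*-monoˡ-≤-nonNeg (+ weight (suc i)) 1≤gap ⟩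
        + weight (suc i) * planeGap i v m   ≡⟨ sym (level-inside v m i<r) ⟩
        level (suc i) v m                   ∎
        where
        open ℤ.≤-Reasoning
        1≤gap : + 1 ℤ.≤ planeGap i v m
        1≤gap = gap-other-block (digit≢ ∘ sym) (dropDigits≤M v<M (suc i)) (dropDigits≤M m<M (suc i))

      level≤-weight : ∀ i → suc i ℕ.< r → digit i m ≡ digit i v → dropDigits (suc i) m ≢ dropDigits (suc i) v →
                      level (suc i) v m ℤ.≤ - + weight (suc i)
      level≤-weight i i<r digit≡ drop≢ = begin
        level (suc i) v m                   ≡⟨ level-inside v m i<r ⟩
        + weight (suc i) * planeGap i v m   ≤⟨ ℤ.*-monoˡ-≤-nonNeg (+ weight (suc i)) gap≤-1 ⟩
        + weight (suc i) * ℤ.-1ℤ            ≡⟨ ℤ.*-comm _ ℤ.-1ℤ ⟩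
        ℤ.-1ℤ * + weight (suc i)            ≡⟨ ℤ.-1*i≡-i _ ⟩
        - + weight (suc i)                  ∎
        where
        open ℤ.≤-Reasoning
        gap≤-1 : planeGap i v m ℤ.≤ ℤ.-1ℤ
        gap≤-1 rewrite digit≡ = gap-same-block-≤-1 (digit i v) _ (dropDigits (suc i) m) (drop≢ ∘ sym)

      level-lower-bound : ∀ i → - + (weight i ℕ.* B) ℤ.≤ level i v m
      level-lower-bound zero = ℤ.neg-≤-pos
      level-lower-bound (suc i) with suc i ℕ.<? r
      ... | no  _ = ℤ.neg-≤-pos
      ... | yes _ = begin
        - + (weight (suc i) ℕ.* B)          ≡⟨ cong -_ (ℤ.pos-* (weight (suc i)) B) ⟩
        - (+ weight (suc i) * + B)          ≡⟨ ℤ.neg-distribʳ-* (+ weight (suc i)) (+ B) ⟩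
        + weight (suc i) * - + B            ≤⟨ ℤ.*-monoˡ-≤-nonNeg (+ weight (suc i)) -B≤gap ⟩
        + weight (suc i) * planeGap i v m   ∎
        where
        open ℤ.≤-Reasoning
        -B≤gap : - + B ℤ.≤ planeGap i v m
        -B≤gap = gap-lower-bound (digit i v) _ (digit i m) _ (dropDigits≤M v<M (suc i)) (dropDigits≤M m<M (suc i))

      -- The weights grow by the factor B + 1, so one negative unit at level i + 1
      -- outweighs the most negative possible value at level i.
      level-drops-at-suffix : ∀ i → digit i m ≡ digit i v → dropDigits (suc i) m ≢ dropDigits (suc i) v →
                              level (suc i) v m ℤ.< level i v m
      level-drops-at-suffix i digit≡ drop≢ = begin-strict
        level (suc i) v m           ≤⟨ level≤-weight i i<r digit≡ drop≢ ⟩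
        - + weight (suc i)          <⟨ ℤ.neg-mono-< (+<+ (weight*B<weight-suc i)) ⟩
        - + (weight i ℕ.* B)        ≤⟨ level-lower-bound i ⟩
        level i v m                 ∎
        where
        open ℤ.≤-Reasoning
        i<r : suc i ℕ.< r
        i<r with suc i ℕ.<? r
        ... | yes i<r = i<r
        ... | no  i≮r = ⊥-elim (drop≢ (trans (dropDigits-beyond m<M) (sym (dropDigits-beyond v<M))))
          where
          dropDigits-beyond : ∀ {u} → u ℕ.< M → dropDigits (suc i) u ≡ 0
          dropDigits-beyond u<M = dropDigits-small (suc i) _ (ℕ.<-≤-trans u<M (ℕ.^-monoʳ-≤ s (ℕ.≮⇒≥ i≮r)))

      level-step : ∀ i → i ℕ.< r → digit i m ≡ digit i v →
                   level (suc i) v m ℤ.< level i v m ⊎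
                   (level (suc i) v m ≡ level i v m × dropDigits (i ∸ 1) m ≡ dropDigits (i ∸ 1) v)
      level-step i i<r digit≡ with dropDigits (suc i) m ℕ.≟ dropDigits (suc i) v
      ... | no  drop≢ = inj₁ (level-drops-at-suffix i digit≡ drop≢)
      level-step zero    _   digit≡ | yes drop≡ = inj₂ (level-agree 0 digit≡ drop≡ , dropDigits-cong 0 digit≡ drop≡)
      level-step (suc j) j<r digit≡ | yes drop≡ with digit j m ℕ.≟ digit j v
      ... | no  digit≢  =
        inj₁ (subst (ℤ._< level (suc j) v m) (sym (level-agree (suc j) digit≡ drop≡)) (0<level j j<r digit≢))
      ... | yes digit≡′ = inj₂ (trans (level-agree (suc j) digit≡ drop≡) (sym (level-agree j digit≡′ drop≡″)) ,
                                  dropDigits-cong j digit≡′ drop≡″)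
        where
        drop≡″ : dropDigits (suc j) m ≡ dropDigits (suc j) v
        drop≡″ = dropDigits-cong (suc j) digit≡ drop≡

module Construction (ℝ : CompleteOrderedField) (d r s : ℕ) .{{_ : NonZero s}}
                    (2≤r : 2 ℕ.≤ r) (2r-2≤d : 2 ℕ.* r ∸ 2 ℕ.≤ d) where
  open CompleteOrderedField ℝ
  open OrderedField ℝ
  open Convexity ℝ
  open Geometry ℝ
  open Digits s
  open Levels r s
  open TangentGap M

  planeCoordinate : ℕ → ℕ → ℕ → ℤ
  planeCoordinate m q zero          = X (digit q m) (dropDigits (suc q) m)
  planeCoordinate m q (suc zero)    = Y (digit q m) (dropDigits (suc q) m)
  planeCoordinate m q (suc (suc j)) = planeCoordinate m (suc q) j

  point : ℕ → Point d
  point m j = ι (planeCoordinate m 0 (toℕ j))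

  planeCoordinate-skip : ∀ m p q b → planeCoordinate m p (q ℕ.+ q ℕ.+ b) ≡ planeCoordinate m (q ℕ.+ p) b
  planeCoordinate-skip m p zero    b = refl
  planeCoordinate-skip m p (suc q) b = begin
    planeCoordinate m p (suc (q ℕ.+ suc q ℕ.+ b))
      ≡⟨ cong (λ j → planeCoordinate m p (suc (j ℕ.+ b))) (ℕ.+-suc q q) ⟩
    planeCoordinate m (suc p) (q ℕ.+ q ℕ.+ b)
      ≡⟨ planeCoordinate-skip m (suc p) q b ⟩
    planeCoordinate m (q ℕ.+ suc p) b
      ≡⟨ cong (λ p′ → planeCoordinate m p′ b) (ℕ.+-suc q p) ⟩
    planeCoordinate m (suc q ℕ.+ p) b
      ∎
    where open ≡-Reasoning

  y-index<d : ∀ q → suc q ℕ.< r → suc (q ℕ.+ q) ℕ.< d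
  y-index<d q q<r = ℕ.≤-trans (begin
    suc (suc (q ℕ.+ q))      ≡⟨ double q ⟩
    2 ℕ.* suc q              ≡⟨ sym (ℕ.m+n∸m≡n 2 (2 ℕ.* suc q)) ⟩
    2 ℕ.+ 2 ℕ.* suc q ∸ 2    ≡⟨ cong (_∸ 2) (sym (ℕ.*-suc 2 (suc q))) ⟩
    2 ℕ.* suc (suc q) ∸ 2    ≤⟨ ℕ.∸-monoˡ-≤ 2 (ℕ.*-monoʳ-≤ 2 q<r) ⟩
    2 ℕ.* r ∸ 2              ∎) 2r-2≤d
    where
    open ℕ.≤-Reasoning
    double : ∀ n → suc (suc (n ℕ.+ n)) ≡ 2 ℕ.* suc n
    double = ℕ.solve-∀

  x-index<d : ∀ q → suc q ℕ.< r → q ℕ.+ q ℕ.< d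
  x-index<d q q<r = ℕ.<⇒≤ (y-index<d q q<r)

  xIndex yIndex : ∀ q → suc q ℕ.< r → Fin d
  xIndex q q<r = fromℕ< (x-index<d q q<r)
  yIndex q q<r = fromℕ< (y-index<d q q<r)

  point-X : ∀ m q q<r → point m (xIndex q q<r) ≡ ι (X (digit q m) (dropDigits (suc q) m))
  point-X m q q<r = cong ι (begin
    planeCoordinate m 0 (toℕ (xIndex q q<r))   ≡⟨ cong (planeCoordinate m 0) (Fin.toℕ-fromℕ< (x-index<d q q<r)) ⟩
    planeCoordinate m 0 (q ℕ.+ q)               ≡⟨ cong (planeCoordinate m 0) (sym (ℕ.+-identityʳ (q ℕ.+ q))) ⟩
    planeCoordinate m 0 (q ℕ.+ q ℕ.+ 0)         ≡⟨ planeCoordinate-skip m 0 q 0 ⟩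
    planeCoordinate m (q ℕ.+ 0) 0               ≡⟨ cong (λ p → planeCoordinate m p 0) (ℕ.+-identityʳ q) ⟩
    planeCoordinate m q 0                       ∎)
    where open ≡-Reasoning

  point-Y : ∀ m q q<r → point m (yIndex q q<r) ≡ ι (Y (digit q m) (dropDigits (suc q) m))
  point-Y m q q<r = cong ι (begin
    planeCoordinate m 0 (toℕ (yIndex q q<r))   ≡⟨ cong (planeCoordinate m 0) (Fin.toℕ-fromℕ< (y-index<d q q<r)) ⟩
    planeCoordinate m 0 (suc (q ℕ.+ q))         ≡⟨ cong (planeCoordinate m 0) (ℕ.+-comm 1 (q ℕ.+ q)) ⟩
    planeCoordinate m 0 (q ℕ.+ q ℕ.+ 1)         ≡⟨ planeCoordinate-skip m 0 q 1 ⟩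
    planeCoordinate m (q ℕ.+ 0) 1               ≡⟨ cong (λ p → planeCoordinate m p 1) (ℕ.+-identityʳ q) ⟩
    planeCoordinate m q 1                       ∎)
    where open ≡-Reasoning

  planeForm : ∀ q v → suc q ℕ.< r → Point d → R
  planeForm q v q<r x =
    ι (ℤ.+ weight (suc q)) * (x (yIndex q q<r) + - ι (slope a w) * x (xIndex q q<r) + - ι (intercept a w))
    where
    a = digit q v
    w = dropDigits (suc q) v

  planeForm-affine : ∀ q v q<r → Affine (planeForm q v q<r)
  planeForm-affine q v q<r =
    affine-* _ (affine-+ (affine-+ (affine-coordinate _) (affine-* _ (affine-coordinate _))) (affine-const _))

  planeForm-point : ∀ q v m q<r → planeForm q v q<r (point m) ≡ ι (ℤ.+ weight (suc q) ℤ.* planeGap q v m)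
  planeForm-point q v m q<r = begin
    planeForm q v q<r (point m)
      ≡⟨ cong₂ (λ y x → ι (ℤ.+ weight (suc q)) * (y + - ι (slope a w) * x + - ι (intercept a w)))
               (point-Y m q q<r) (point-X m q q<r) ⟩
    ι (ℤ.+ weight (suc q)) * (ι (Y a′ w′) + - ι (slope a w) * ι (X a′ w′) + - ι (intercept a w))
      ≡⟨ sym (ι-line (ℤ.+ weight (suc q)) (Y a′ w′) (slope a w) (X a′ w′) (intercept a w)) ⟩
    ι (ℤ.+ weight (suc q) ℤ.* planeGap q v m)
      ∎
    where
    open ≡-Reasoning
    a  = digit q v
    w  = dropDigits (suc q) v
    a′ = digit q m
    w′ = dropDigits (suc q) m

  L : ℕ → ℕ → Point d → R
  L zero    v x = 0#
  L (suc q) v x with suc q ℕ.<? r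
  ... | yes q<r = planeForm q v q<r x
  ... | no  _   = 0#

  L-affine : ∀ i v → Affine (L i v)
  L-affine zero    v = affine-const 0#
  L-affine (suc q) v t x y with suc q ℕ.<? r
  ... | yes q<r = planeForm-affine q v q<r t x y
  ... | no  _   = affine-const 0# t x y

  L-point : ∀ i v m → L i v (point m) ≡ ι (level i v m)
  L-point zero    v m = refl
  L-point (suc q) v m with suc q ℕ.<? r
  ... | yes q<r = planeForm-point q v m q<r
  ... | no  _   = refl

  L-beyond : ∀ {t} v x → r ℕ.≤ t → L t v x ≡ 0#
  L-beyond {zero}  v x _   = refl
  L-beyond {suc q} v x r≤t with suc q ℕ.<? r
  ... | yes q<r = ⊥-elim (ℕ.<⇒≱ q<r r≤t)
  ... | no  _   = refl

  point-injective : ∀ {m m′} → m ℕ.< M → m′ ℕ.< M → point m ≡ point m′ → m ≡ m′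
  point-injective {m} {m′} m<M m′<M point≡ = dropDigits-cong 0 (proj₁ digits≡) (proj₂ digits≡)
    where
    X≡ : X (digit 0 m) (dropDigits 1 m) ≡ X (digit 0 m′) (dropDigits 1 m′)
    X≡ = ι-injective (trans (sym (point-X m 0 2≤r)) (trans (cong (λ p → p (xIndex 0 2≤r)) point≡) (point-X m′ 0 2≤r)))
    digits≡ = X-injective (dropDigits≤M m<M 1) (dropDigits≤M m′<M 1) X≡

  labelled : ∀ {n} → Fin n → Point d
  labelled k = point (toℕ k)

  module _ {n : ℕ} (n≤M : n ℕ.≤ M) (c : Fin n → Fin r) where

    ColourZero : ℕ → Set
    ColourZero v = Σ (Fin n) λ k → toℕ k ≡ v × toℕ (c k) ≡ 0

    Strict : ℕ → ℕ → Set
    Strict zero          v = ¬ ColourZero v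
    Strict (suc zero)    v = ColourZero v
    Strict (suc (suc _)) v = ⊥

    Below : ℕ → ℕ → Subset d
    Below i v x = (L (suc i) v x ≤ L i v x) × (Strict i v → L (suc i) v x < L i v x)

    Piece : Fin r → Fin s → Subset d
    Piece i j x = ∀ v → v ℕ.< M → digit (toℕ i) v ≡ toℕ j → Below (toℕ i) v x

    C : Fin r → Subset d
    C i x = Σ (Fin s) λ j → Piece i j x

    C-sconvex : ∀ i → SConvex s (C i)
    C-sconvex i = Piece i , piece-convex , λ x → mk⇔ id id
      where
      piece-convex : ∀ j → Convex (Piece i j)
      piece-convex j = convex-Π λ v → convex-Π λ _ → convex-Π λ _ →
        convex-× (convex-≤ (L-affine (suc i′) v) (L-affine i′ v))
                 (convex-Π λ _ → convex-< (L-affine (suc i′) v) (L-affine i′ v))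
        where i′ = toℕ i

    strict-separates : ∀ i {k v} → toℕ (c k) ≡ i → Strict i v → dropDigits (i ∸ 1) (toℕ k) ≢ dropDigits (i ∸ 1) v
    strict-separates zero       {k} ck≡0 not-zero k≡v = not-zero (k , k≡v , ck≡0)
    strict-separates (suc zero) {k} ck≡1 (k′ , k′≡v , ck′≡0) k≡v
      with Fin.toℕ-injective (trans k≡v (sym k′≡v))
    ... | refl with trans (sym ck≡1) ck′≡0
    ... | ()

    below-labelled : ∀ k v → v ℕ.< M → digit (toℕ (c k)) v ≡ digit (toℕ (c k)) (toℕ k) →
                     Below (toℕ (c k)) v (labelled k)
    below-labelled k v v<M digit≡ =
      [ (λ level< → inj₁ (L-< level<) , λ _ → L-< level<)
      , (λ (level≡ , drop≡) → inj₂ (L-≡ level≡) , λ strict → ⊥-elim (strict-separates i refl strict drop≡))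
      ]′ (level-step v<M (ℕ.<-≤-trans (Fin.toℕ<n k) n≤M) i (Fin.toℕ<n (c k)) (sym digit≡))
      where
      i = toℕ (c k)
      m = toℕ k
      L-< : level (suc i) v m ℤ.< level i v m → L (suc i) v (labelled k) < L i v (labelled k)
      L-< = subst₂ _<_ (sym (L-point (suc i) v m)) (sym (L-point i v m)) ∘ ι-mono-<
      L-≡ : level (suc i) v m ≡ level i v m → L (suc i) v (labelled k) ≡ L i v (labelled k)
      L-≡ level≡ = trans (L-point (suc i) v m) (trans (cong ι level≡) (sym (L-point i v m)))

    cover : ∀ k → C (c k) (labelled k)
    cover k = fromℕ< digit<s′ , λ v v<M digit≡ → below-labelled k v v<M (trans digit≡ (Fin.toℕ-fromℕ< digit<s′))
      where digit<s′ = digit<s (toℕ (c k)) (toℕ k)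

    no-common-point : ¬ (Σ (Point d) λ x → ∀ i → C i x)
    no-common-point (x , in-all) = <-irrefl (≤-<-trans (0≤L 1 1≤r) L1<0)
      where
      v = encode r (proj₁ ∘ in-all)
      below : ∀ i → i ℕ.< r → Below i v x
      below i i<r = subst (λ i′ → Below i′ v x) (Fin.toℕ-fromℕ< i<r)
        (proj₂ (in-all (fromℕ< i<r)) v (encode<s^r r _) (digit-encode r _ (fromℕ< i<r)))
      0≤L : ∀ j → j ℕ.≤ r → 0# ≤ L j v x
      0≤L j j≤r = subst (_≤ L j v x) (L-beyond v x ℕ.≤-refl)
        (descending-chain (λ i → L i v x) r (λ i i<r → proj₁ (below i i<r)) j j≤r)
      1≤r = ℕ.<⇒≤ 2≤r
      not-colour-zero : ¬ ColourZero v
      not-colour-zero colour-zero =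
        <-irrefl (≤-<-trans (0≤L 2 2≤r) (<-≤-trans (proj₂ (below 1 2≤r) colour-zero) (proj₁ (below 0 1≤r))))
      L1<0 : L 1 v x < 0#
      L1<0 = proj₂ (below 0 1≤r) not-colour-zero

  labelled-injective : ∀ {n} → n ℕ.≤ M → Injective _≡_ _≡_ (labelled {n})
  labelled-injective n≤M {k} {k′} = Fin.toℕ-injective ∘ point-injective (bound k) (bound k′)
    where bound = λ (k : Fin _) → ℕ.<-≤-trans (Fin.toℕ<n k) n≤M

open import Data.Nat using (_≤_; _*_; _<_; >-nonZero)
open import Data.Nat.Properties using (≰⇒>)

theorem1p4 : (ℝ : CompleteOrderedField) → (d r s : ℕ) → 1 ≤ s → 2 ≤ r → 2 * r ∸ 2 ≤ d →
    Geometry.FGreater ℝ {d} {r} (λ _ → s) (s ^ r)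
theorem1p4 ℝ d r s 1≤s 2≤r 2r-2≤d n all-admit = ≰⇒> λ n≤s^r →
  let c , good = all-admit labelled (labelled-injective n≤s^r)
  in no-common-point n≤s^r c (good (C n≤s^r c) (C-sconvex n≤s^r c) (cover n≤s^r c))
  where open Construction ℝ d r s {{>-nonZero 1≤s}} 2≤r 2r-2≤d
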